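{- Let $T$ be a rooted tree with $L\ge1$ leaves and let $d\ge1$ be an integer. For a node $v$ of $T$, let $N_d(v)$ denote the number of descendants of $v$ at distance exactly $d$ from $v$. Then for every subset $S$ of the nodes of $T$, $$\sum_{v\in S}N_d(v)\le d\cdot(L-1)+|S|.$$ -}

module Defs where

open import Data.Nat using (ℕ; zero; suc; _+_)
open import Data.List using (List; []; _∷_)
open import Data.Bool using (Bool; if_then_else_)

data Tree : Set where
  node : List Tree → Tree

-- Nodes of a tree, given as paths from the root.
mutual
  data Pos : Tree → Set where
    here : ∀ {t} → Pos t
    down : ∀ {ts} → PosL ts → Pos (node ts)

  data PosL : List Tree → Set where
    hd : ∀ {t ts} → Pos t → PosL (t ∷ ts)
    tl : ∀ {t ts} → PosL ts → PosL (t ∷ ts)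

mutual
  subtree : (t : Tree) → Pos t → Tree
  subtree t here = t
  subtree (node ts) (down p) = subtreeL ts p

  subtreeL : (ts : List Tree) → PosL ts → Tree
  subtreeL (t ∷ ts) (hd p) = subtree t p
  subtreeL (t ∷ ts) (tl p) = subtreeL ts p

mutual
  sumPos : (t : Tree) → (Pos t → ℕ) → ℕ
  sumPos (node ts) f = f here + sumPosL ts (λ p → f (down p))

  sumPosL : (ts : List Tree) → (PosL ts → ℕ) → ℕ
  sumPosL [] f = 0
  sumPosL (t ∷ ts) f = sumPos t (λ p → f (hd p)) + sumPosL ts (λ p → f (tl p))

mutual
  leaves : Tree → ℕ
  leaves (node []) = 1
  leaves (node (t ∷ ts)) = leavesL (t ∷ ts)

  leavesL : List Tree → ℕ
  leavesL [] = 0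
  leavesL (t ∷ ts) = leaves t + leavesL ts

mutual
  atDepth : ℕ → Tree → ℕ
  atDepth zero t = 1
  atDepth (suc d) (node ts) = atDepthL d ts

  atDepthL : ℕ → List Tree → ℕ
  atDepthL d [] = 0
  atDepthL d (t ∷ ts) = atDepth d t + atDepthL d ts

N : ℕ → (t : Tree) → Pos t → ℕ
N d t v = atDepth d (subtree t v)

card : (t : Tree) → (Pos t → Bool) → ℕ
card t S = sumPos t (λ v → if S v then 1 else 0)

sumOver : (t : Tree) → (Pos t → Bool) → (Pos t → ℕ) → ℕ
sumOver t S f = sumPos t (λ v → if S v then f v else 0)

-- Write A_m(t) for the number of nodes of t at depth m and x⁺ for x ∸ 1.  If a
-- node has k ≥ 1 children c, then A_{m+1}(node)⁺ + 1 ≤ Σ_c A_m(c)⁺ + k.  Summing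
-- this over m < d lets the potential  Σ_v N_d(v)⁺ + Σ_{m<d} A_m(t)⁺ + d  of a
-- tree be bounded by d · leaves t, by induction from the children to the parent;
-- hence Σ_v N_d(v)⁺ ≤ d · (leaves t ∸ 1).  The theorem follows from
-- N_d(v) ≤ N_d(v)⁺ + [v ∈ S].
module Submission where

open import Defs
open import Data.Nat using (ℕ; zero; suc; _+_; _*_; _∸_; _≤_; z≤n; s≤s)
open import Data.Nat.Properties
open import Data.Nat.Tactic.RingSolver using (solve-∀)
open import Data.Bool using (Bool; true; false; if_then_else_)
open import Data.List using (List; []; _∷_; length; map)
open import Data.Nat.ListAction using (sum)
open import Relation.Binary.PropositionalEquality
open import Algebra.Properties.CommutativeSemigroup +-commutativeSemigroup using (interchange)

mutual
  sumPos-+ : ∀ t (f g : Pos t → ℕ) →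
    sumPos t (λ v → f v + g v) ≡ sumPos t f + sumPos t g
  sumPos-+ (node ts) f g =
    trans (cong (f here + g here +_) (sumPosL-+ ts (λ p → f (down p)) (λ p → g (down p))))
          (interchange (f here) (g here) _ _)

  sumPosL-+ : ∀ ts (f g : PosL ts → ℕ) →
    sumPosL ts (λ p → f p + g p) ≡ sumPosL ts f + sumPosL ts g
  sumPosL-+ [] f g = refl
  sumPosL-+ (t ∷ ts) f g =
    trans (cong₂ _+_ (sumPos-+ t (λ p → f (hd p)) (λ p → g (hd p)))
                     (sumPosL-+ ts (λ p → f (tl p)) (λ p → g (tl p))))
          (interchange (sumPos t (λ p → f (hd p))) (sumPos t (λ p → g (hd p))) _ _)

mutual
  sumPos-mono-≤ : ∀ t {f g : Pos t → ℕ} → (∀ v → f v ≤ g v) → sumPos t f ≤ sumPos t g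
  sumPos-mono-≤ (node ts) f≤g =
    +-mono-≤ (f≤g here) (sumPosL-mono-≤ ts (λ p → f≤g (down p)))

  sumPosL-mono-≤ : ∀ ts {f g : PosL ts → ℕ} → (∀ p → f p ≤ g p) → sumPosL ts f ≤ sumPosL ts g
  sumPosL-mono-≤ [] f≤g = z≤n
  sumPosL-mono-≤ (t ∷ ts) f≤g =
    +-mono-≤ (sumPos-mono-≤ t (λ p → f≤g (hd p))) (sumPosL-mono-≤ ts (λ p → f≤g (tl p)))

module _ {A : Set} where

  sum-map-+ : ∀ (f g : A → ℕ) xs →
    sum (map (λ x → f x + g x) xs) ≡ sum (map f xs) + sum (map g xs)
  sum-map-+ f g [] = refl
  sum-map-+ f g (x ∷ xs) =
    trans (cong (f x + g x +_) (sum-map-+ f g xs)) (interchange (f x) (g x) _ _)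

  sum-map-const : ∀ c (xs : List A) → sum (map (λ _ → c) xs) ≡ c * length xs
  sum-map-const c [] = sym (*-zeroʳ c)
  sum-map-const c (x ∷ xs) = trans (cong (c +_) (sum-map-const c xs)) (sym (*-suc c (length xs)))

  sum-map-mono-≤ : ∀ {f g : A → ℕ} → (∀ x → f x ≤ g x) → ∀ xs → sum (map f xs) ≤ sum (map g xs)
  sum-map-mono-≤ f≤g [] = z≤n
  sum-map-mono-≤ f≤g (x ∷ xs) = +-mono-≤ (f≤g x) (sum-map-mono-≤ f≤g xs)

atDepthL≡sum : ∀ m ts → atDepthL m ts ≡ sum (map (atDepth m) ts)
atDepthL≡sum m [] = refl
atDepthL≡sum m (t ∷ ts) = cong (atDepth m t +_) (atDepthL≡sum m ts)

leavesL≡sum : ∀ ts → leavesL ts ≡ sum (map leaves ts)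
leavesL≡sum [] = refl
leavesL≡sum (t ∷ ts) = cong (leaves t +_) (leavesL≡sum ts)

excess : ℕ → Tree → ℕ
excess m t = atDepth m t ∸ 1

excessBelow : ℕ → Tree → ℕ
excessBelow zero t = 0
excessBelow (suc m) t = excessBelow m t + excess m t

totalExcess : ℕ → Tree → ℕ
totalExcess d t = sumPos t (λ v → excess d (subtree t v))

excess-leaf : ∀ m → excess m (node []) ≡ 0
excess-leaf zero = refl
excess-leaf (suc m) = refl

excessBelow-leaf : ∀ d → excessBelow d (node []) ≡ 0
excessBelow-leaf zero = refl
excessBelow-leaf (suc d) = cong₂ _+_ (excessBelow-leaf d) (excess-leaf d)

potential : ℕ → Tree → ℕ
potential d t = totalExcess d t + (excessBelow d t + d)

totalExcess-node : ∀ d ts →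
  totalExcess d (node ts) ≡ excess d (node ts) + sum (map (totalExcess d) ts)
totalExcess-node d ts = cong (excess d (node ts) +_) (forest ts)
  where
  forest : ∀ ts → sumPosL ts (λ p → excess d (subtreeL ts p)) ≡ sum (map (totalExcess d) ts)
  forest [] = refl
  forest (t ∷ ts) = cong (totalExcess d t +_) (forest ts)

atDepth≤excess+1 : ∀ m t → atDepth m t ≤ excess m t + 1
atDepth≤excess+1 m t = ≤-trans (m≤n+m∸n (atDepth m t) 1) (≤-reflexive (+-comm 1 (excess m t)))

excess-node : ∀ m t ts → let cs = t ∷ ts in
  excess (suc m) (node cs) + 1 ≤ sum (map (excess m) cs) + length cs
excess-node m t ts = m≤o∸n⇒m+n≤o _ 1≤rhs (∸-monoˡ-≤ 1 atDepth≤rhs)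
  where
  cs = t ∷ ts
  open ≤-Reasoning
  atDepth≤rhs : atDepth (suc m) (node cs) ≤ sum (map (excess m) cs) + length cs
  atDepth≤rhs = begin
    atDepthL m cs                                   ≡⟨ atDepthL≡sum m cs ⟩
    sum (map (atDepth m) cs)                        ≤⟨ sum-map-mono-≤ (atDepth≤excess+1 m) cs ⟩
    sum (map (λ c → excess m c + 1) cs)             ≡⟨ sum-map-+ (excess m) (λ _ → 1) cs ⟩
    sum (map (excess m) cs) + sum (map (λ _ → 1) cs) ≡⟨ cong (sum (map (excess m) cs) +_)
                                                         (trans (sum-map-const 1 cs) (*-identityˡ _)) ⟩
    sum (map (excess m) cs) + length cs             ∎
  1≤rhs : 1 ≤ sum (map (excess m) cs) + length cs
  1≤rhs = m≤n⇒m≤o+n (sum (map (excess m) cs)) (s≤s z≤n)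

excessBelow-node : ∀ d t ts → let cs = t ∷ ts in
  excessBelow (suc d) (node cs) + d ≤ sum (map (excessBelow d) cs) + d * length cs
excessBelow-node zero t ts = z≤n
excessBelow-node (suc d) t ts = begin
  excessBelow (suc d) (node cs) + excess (suc d) (node cs) + suc d
    ≡⟨ regroup (excessBelow (suc d) (node cs)) (excess (suc d) (node cs)) d ⟩
  (excessBelow (suc d) (node cs) + d) + (excess (suc d) (node cs) + 1)
    ≤⟨ +-mono-≤ (excessBelow-node d t ts) (excess-node d t ts) ⟩
  (sum (map (excessBelow d) cs) + d * k) + (sum (map (excess d) cs) + k)
    ≡⟨ interchange (sum (map (excessBelow d) cs)) (d * k) (sum (map (excess d) cs)) k ⟩
  (sum (map (excessBelow d) cs) + sum (map (excess d) cs)) + (d * k + k)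
    ≡⟨ cong₂ _+_ (sym (sum-map-+ (excessBelow d) (excess d) cs)) (+-comm (d * k) k) ⟩
  sum (map (excessBelow (suc d)) cs) + suc d * k ∎
  where
  cs = t ∷ ts
  k = length cs
  open ≤-Reasoning
  regroup : ∀ b e d → b + e + suc d ≡ (b + d) + (e + 1)
  regroup = solve-∀

potential-node : ∀ d ts → potential d (node ts) ≡
  sum (map (totalExcess d) ts) + (excessBelow (suc d) (node ts) + d)
potential-node d ts = begin
  totalExcess d (node ts) + (excessBelow d (node ts) + d)
    ≡⟨ cong (_+ (excessBelow d (node ts) + d)) (totalExcess-node d ts) ⟩
  (excess d (node ts) + sum (map (totalExcess d) ts)) + (excessBelow d (node ts) + d)
    ≡⟨ regroup (excess d (node ts)) _ _ d ⟩
  sum (map (totalExcess d) ts) + ((excessBelow d (node ts) + excess d (node ts)) + d) ∎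
  where
  open ≡-Reasoning
  regroup : ∀ e s b d → (e + s) + (b + d) ≡ s + ((b + e) + d)
  regroup = solve-∀

sum-map-potential : ∀ d ts → sum (map (potential d) ts) ≡
  sum (map (totalExcess d) ts) + (sum (map (excessBelow d) ts) + d * length ts)
sum-map-potential d ts = begin
  sum (map (potential d) ts)
    ≡⟨ sum-map-+ (totalExcess d) (λ t → excessBelow d t + d) ts ⟩
  sum (map (totalExcess d) ts) + sum (map (λ t → excessBelow d t + d) ts)
    ≡⟨ cong (sum (map (totalExcess d) ts) +_)
            (trans (sum-map-+ (excessBelow d) (λ _ → d) ts)
                   (cong (sum (map (excessBelow d) ts) +_) (sum-map-const d ts))) ⟩
  sum (map (totalExcess d) ts) + (sum (map (excessBelow d) ts) + d * length ts) ∎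
  where open ≡-Reasoning

mutual
  potential≤ : ∀ d t → potential d t ≤ d * leaves t
  potential≤ d (node []) = ≤-reflexive (begin-equality
    (excess d (node []) + 0) + (excessBelow d (node []) + d)
      ≡⟨ cong₂ (λ x y → (x + 0) + (y + d)) (excess-leaf d) (excessBelow-leaf d) ⟩
    d
      ≡⟨ sym (*-identityʳ d) ⟩
    d * 1 ∎)
    where open ≤-Reasoning
  potential≤ d (node cs@(t ∷ ts)) = begin
    potential d (node cs)
      ≡⟨ potential-node d cs ⟩
    sum (map (totalExcess d) cs) + (excessBelow (suc d) (node cs) + d)
      ≤⟨ +-monoʳ-≤ (sum (map (totalExcess d) cs)) (excessBelow-node d t ts) ⟩
    sum (map (totalExcess d) cs) + (sum (map (excessBelow d) cs) + d * length cs)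
      ≡⟨ sum-map-potential d cs ⟨
    sum (map (potential d) cs)
      ≤⟨ potentials≤ d cs ⟩
    d * sum (map leaves cs)
      ≡⟨ cong (d *_) (leavesL≡sum cs) ⟨
    d * leaves (node cs) ∎
    where open ≤-Reasoning

  potentials≤ : ∀ d ts → sum (map (potential d) ts) ≤ d * sum (map leaves ts)
  potentials≤ d [] = ≤-reflexive (sym (*-zeroʳ d))
  potentials≤ d (t ∷ ts) =
    ≤-trans (+-mono-≤ (potential≤ d t) (potentials≤ d ts))
            (≤-reflexive (sym (*-distribˡ-+ d (leaves t) _)))

totalExcess≤ : ∀ d t → totalExcess d t ≤ d * (leaves t ∸ 1)
totalExcess≤ d t = begin
  totalExcess d t            ≤⟨ m+n≤o⇒m≤o∸n _ totalExcess+d≤ ⟩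
  d * leaves t ∸ d           ≡⟨ cong (d * leaves t ∸_) (sym (*-identityʳ d)) ⟩
  d * leaves t ∸ d * 1       ≡⟨ sym (*-distribˡ-∸ d (leaves t) 1) ⟩
  d * (leaves t ∸ 1)         ∎
  where
  open ≤-Reasoning
  totalExcess+d≤ : totalExcess d t + d ≤ d * leaves t
  totalExcess+d≤ = ≤-trans (+-monoʳ-≤ (totalExcess d t) (m≤n+m d (excessBelow d t))) (potential≤ d t)

selected≤pred+indicator : ∀ (b : Bool) n → (if b then n else 0) ≤ (n ∸ 1) + (if b then 1 else 0)
selected≤pred+indicator true n = ≤-trans (m≤n+m∸n n 1) (≤-reflexive (+-comm 1 (n ∸ 1)))
selected≤pred+indicator false n = z≤n

mainTheorem13 : (T : Tree) → (d : ℕ) → 1 ≤ d → 1 ≤ leaves T → (S : Pos T → Bool) →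
    sumOver T S (N d T) ≤ d * (leaves T ∸ 1) + card T S
mainTheorem13 T d _ _ S = begin
  sumOver T S (N d T)
    ≤⟨ sumPos-mono-≤ T (λ v → selected≤pred+indicator (S v) (N d T v)) ⟩
  sumPos T (λ v → excess d (subtree T v) + (if S v then 1 else 0))
    ≡⟨ sumPos-+ T (λ v → excess d (subtree T v)) (λ v → if S v then 1 else 0) ⟩
  totalExcess d T + card T S
    ≤⟨ +-monoˡ-≤ (card T S) (totalExcess≤ d T) ⟩
  d * (leaves T ∸ 1) + card T S ∎
  where open ≤-Reasoning
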